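{- Let $R$ be a commutative ring, let $a\in R$ be a nilpotent element of nilpotency index $k$, and let $s>1$ be the characteristic of the quotient ring $R/\langle a\rangle$. Then: (1) If $w$ is a natural number with $\bar x^{\,w}=\bar 1$ for all $\bar x\in (R/\langle a\rangle)^*$, then $x^{w s^{k-1}}=1$ for all $x\in R^*$. (2) If $(R/\langle a\rangle)^*$ is finite, then $x^{|(R/\langle a\rangle)^*|\, s^{k-1}}=1$ for all $x\in R^*$. (3) If $R^*$ is finite, then $x^{|(R/\langle a\rangle)^*|\,|\langle a\rangle|}=1$ for all $x\in R^*$.
   Context: Rings have identity; $S^*$ denotes the group of units of a ring $S$; $\langle a\rangle$ is the ideal generated by $a$. The characteristic of a ring $S$ is the least positive integer $s$ with $s\cdot 1_S=0$. The nilpotency index of $a$ is the least $k$ with $a^k=0$. -}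

module Defs where

open import Level using (_⊔_; Lift)
open import Algebra.Bundles using (CommutativeRing)
import Algebra.Definitions.RawSemiring as RawSemiringDefs
open import Data.Nat using (ℕ; zero; suc; _<_)
open import Data.Fin using (Fin)
open import Data.Product using (Σ; ∃; _×_; _,_)
open import Relation.Binary.PropositionalEquality using (_≡_)
open import Relation.Nullary using (¬_)

module _ {c ℓ} (R : CommutativeRing c ℓ) where
  open CommutativeRing R
  open import Algebra.Bundles using (Semiring)
  open RawSemiringDefs (Semiring.rawSemiring semiring) using (_^_) renaming (_×_ to _·_)

  pow : Carrier → ℕ → Carrier
  pow x n = x ^ n

  Eq : Carrier → Carrier → Set ℓ
  Eq = _≈_

  one : Carrier
  one = 1#

  InIdeal : Carrier → Carrier → Set (c ⊔ ℓ)
  InIdeal a x = ∃ λ r → x ≈ r * a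

  -- x ≡ y in R/⟨a⟩, i.e. x̄ = ȳ
  CongMod : Carrier → Carrier → Carrier → Set (c ⊔ ℓ)
  CongMod a x y = InIdeal a (x - y)

  IsUnit : Carrier → Set (c ⊔ ℓ)
  IsUnit x = ∃ λ y → x * y ≈ 1#

  -- x̄ ∈ (R/⟨a⟩)^*  (x is a representative of the class x̄)
  IsUnitMod : Carrier → Carrier → Set (c ⊔ ℓ)
  IsUnitMod a x = ∃ λ y → CongMod a (x * y) 1#

  NilpotencyIndex : Carrier → ℕ → Set ℓ
  NilpotencyIndex a k = (a ^ k ≈ 0#) × (∀ j → j < k → ¬ (a ^ j ≈ 0#))

  CharacteristicMod : Carrier → ℕ → Set (c ⊔ ℓ)
  CharacteristicMod a s =
    (0 < s) × CongMod a (s · 1#) 0# × (∀ t → 0 < t → t < s → ¬ CongMod a (t · 1#) 0#)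

  -- A subset P of R, considered up to the equivalence relation E, has
  -- exactly n elements (classes): an enumeration Fin n → Carrier hitting
  -- every class of P exactly once.
  HasCardUpTo : (Carrier → Carrier → Set (c ⊔ ℓ)) → (Carrier → Set (c ⊔ ℓ)) → ℕ → Set (c ⊔ ℓ)
  HasCardUpTo E P n = Σ (Fin n → Carrier) λ f →
      (∀ i → P (f i))
    × (∀ x → P x → ∃ λ i → E x (f i))
    × (∀ i j → E (f i) (f j) → i ≡ j)

  UnitsModCard : Carrier → ℕ → Set (c ⊔ ℓ)
  UnitsModCard a n = HasCardUpTo (CongMod a) (IsUnitMod a) n

  UnitsCard : ℕ → Set (c ⊔ ℓ)
  UnitsCard n = HasCardUpTo (λ x y → Lift (c ⊔ ℓ) (x ≈ y)) IsUnit n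

  IdealCard : Carrier → ℕ → Set (c ⊔ ℓ)
  IdealCard a n = HasCardUpTo (λ x y → Lift (c ⊔ ℓ) (x ≈ y)) (InIdeal a) n

-- Every unit x is a unit modulo a, so x^w = 1 + u with u ∈ ⟨a⟩.  Since s·1 ∈ ⟨a⟩, the
-- congruence (1 + u)^s ≡ 1 + s·u (mod u²) shows that raising to the s-th power moves an
-- element of 1 + ⟨aʲ⟩ into 1 + ⟨aʲ⁺¹⟩; after k - 1 steps we land in 1 + ⟨aᵏ⟩ = {1}.
-- The exponents in (2) and (3) come from Lagrange's argument for a finite abelian group G
-- (multiplying by y ∈ G permutes G, so yⁿ fixes the product of all elements), applied to
-- (R/⟨a⟩)^* and to the group 1 + ⟨a⟩, whose elements are units because a is nilpotent and
-- which is in bijection with ⟨a⟩.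
module Submission where

open import Defs
open import Algebra.Bundles using (CommutativeMonoid; CommutativeRing; Semiring)
import Algebra.Definitions.RawSemiring as RawSemiringDefs
open import Data.Fin using (Fin; zero; suc)
open import Data.Fin.Permutation using (Permutation; permutation)
open import Data.Nat using (ℕ; zero; suc; _<_; _∸_) renaming (_*_ to _*ℕ_; _^_ to _^ℕ_)
import Data.Nat.Properties as ℕ
open import Data.Product using (∃; _×_; _,_; proj₁; proj₂)
open import Level using (_⊔_; lift)
open import Relation.Binary.PropositionalEquality using (_≡_)

module FiniteSubgroups {c ℓ} (M : CommutativeMonoid c ℓ) where
  open CommutativeMonoid M
  import Algebra.Definitions.RawMonoid rawMonoid as Mult
  open import Algebra.Properties.CommutativeMonoid.Sum M
    using (sum; sum-cong-≋; sum-permute; ∑-distrib-+; sum-replicate)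
  open import Algebra.Solver.CommutativeMonoid M using (solve; _⊕_; _⊜_)
  open import Relation.Binary.Reasoning.Setoid setoid

  infixr 8 _^_
  _^_ : Carrier → ℕ → Carrier
  y ^ n = n Mult.× y

  Invertible : Carrier → Set (c ⊔ ℓ)
  Invertible x = ∃ λ y → x ∙ y ≈ ε

  Enumerates : ∀ {p} → (Carrier → Set p) → ∀ {n} → (Fin n → Carrier) → Set _
  Enumerates P f =
      (∀ i → P (f i))
    × (∀ x → P x → ∃ λ i → x ≈ f i)
    × (∀ i j → f i ≈ f j → i ≡ j)

  ∙-invertible : ∀ {x y} → Invertible x → Invertible y → Invertible (x ∙ y)
  ∙-invertible {x} {y} (x' , xx'≈ε) (y' , yy'≈ε) = x' ∙ y' , (begin
    (x ∙ y) ∙ (x' ∙ y') ≈⟨ solve 4 (λ x y x' y' → (x ⊕ y) ⊕ (x' ⊕ y') ⊜ (x ⊕ x') ⊕ (y ⊕ y')) refl x y x' y' ⟩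
    (x ∙ x') ∙ (y ∙ y') ≈⟨ ∙-cong xx'≈ε yy'≈ε ⟩
    ε ∙ ε               ≈⟨ identityˡ ε ⟩
    ε                   ∎)

  sum-invertible : ∀ {n} (f : Fin n → Carrier) → (∀ i → Invertible (f i)) → Invertible (sum f)
  sum-invertible {zero}  f inv = ε , identityˡ ε
  sum-invertible {suc n} f inv =
    ∙-invertible (inv zero) (sum-invertible (λ i → f (suc i)) (λ i → inv (suc i)))

  x∙z≈z⇒x≈ε : ∀ {x z} → Invertible z → x ∙ z ≈ z → x ≈ ε
  x∙z≈z⇒x≈ε {x} {z} (z' , zz'≈ε) xz≈z = begin
    x              ≈⟨ identityʳ x ⟨
    x ∙ ε          ≈⟨ ∙-congˡ zz'≈ε ⟨
    x ∙ (z ∙ z')   ≈⟨ assoc x z z' ⟨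
    (x ∙ z) ∙ z'   ≈⟨ ∙-congʳ xz≈z ⟩
    z ∙ z'         ≈⟨ zz'≈ε ⟩
    ε              ∎

  module _ {p} {P : Carrier → Set p}
           (∙-closed : ∀ {x y} → P x → P y → P (x ∙ y))
           (inverse-closed : ∀ {x} → P x → ∃ λ y → P y × x ∙ y ≈ ε)
           {n} {f : Fin n → Carrier} (enum : Enumerates P f)
           where

    private
      Pf = proj₁ enum
      index = proj₁ (proj₂ enum)
      injective = proj₂ (proj₂ enum)

    translate : ∀ {y} → P y → Fin n → Fin n
    translate Py i = proj₁ (index _ (∙-closed Py (Pf i)))

    translate-≈ : ∀ {y} (Py : P y) i → y ∙ f i ≈ f (translate Py i)
    translate-≈ Py i = proj₂ (index _ (∙-closed Py (Pf i)))

    translate-inverse : ∀ {y y'} (Py : P y) (Py' : P y') → y ∙ y' ≈ ε →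
                        ∀ i → translate Py (translate Py' i) ≡ i
    translate-inverse {y} {y'} Py Py' yy'≈ε i = injective _ _ (begin
      f (translate Py (translate Py' i)) ≈⟨ translate-≈ Py _ ⟨
      y ∙ f (translate Py' i)            ≈⟨ ∙-congˡ (translate-≈ Py' i) ⟨
      y ∙ (y' ∙ f i)                     ≈⟨ assoc y y' (f i) ⟨
      (y ∙ y') ∙ f i                     ≈⟨ ∙-congʳ yy'≈ε ⟩
      ε ∙ f i                            ≈⟨ identityˡ (f i) ⟩
      f i                                ∎)

    translation : ∀ {y} → P y → Permutation n n
    translation {y} Py with inverse-closed Py
    ... | y' , Py' , yy'≈ε = permutation (translate Py) (translate Py')
      (translate-inverse Py Py' yy'≈ε) (translate-inverse Py' Py (trans (comm y' y) yy'≈ε))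

    lagrange : ∀ {y} → P y → y ^ n ≈ ε
    lagrange {y} Py = x∙z≈z⇒x≈ε (sum-invertible f (λ i → invertible (Pf i))) (begin
      y ^ n ∙ sum f              ≈⟨ ∙-congʳ (sum-replicate n) ⟨
      sum {n} (λ _ → y) ∙ sum f  ≈⟨ ∑-distrib-+ (λ _ → y) f ⟨
      sum (λ i → y ∙ f i)        ≈⟨ sum-cong-≋ (translate-≈ Py) ⟩
      sum (λ i → f (translate Py i)) ≈⟨ sum-permute f (translation Py) ⟨
      sum f                      ∎)
      where
      invertible : ∀ {x} → P x → Invertible x
      invertible Px = proj₁ (inverse-closed Px) , proj₂ (proj₂ (inverse-closed Px))

  units-lagrange : ∀ {n} {f : Fin n → Carrier} → Enumerates Invertible f →
                   ∀ {y} → Invertible y → y ^ n ≈ ε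
  units-lagrange = lagrange ∙-invertible (λ {x} (y , xy≈ε) → y , (x , trans (comm y x) xy≈ε) , xy≈ε)

module PrincipalIdeals {c ℓ} (R : CommutativeRing c ℓ) where
  open CommutativeRing R
  open RawSemiringDefs (Semiring.rawSemiring semiring) using (_^_) renaming (_×_ to _·_)
  open import Algebra.Properties.Ring ring using (//-rightDividesˡ; //-rightDividesʳ; ⁻¹-anti-homo‿-; -‿distribˡ-*; +-cancelʳ)
  open import Algebra.Properties.Semiring.Exp semiring using (^-congˡ; ^-congʳ; ^-assocʳ)
  open import Algebra.Properties.CommutativeSemiring.Exp commutativeSemiring using (^-distrib-*)
  open import Algebra.Solver.Ring.NaturalCoefficients.Default commutativeSemiring using (solve; con; _:+_; _:*_; _:=_)
  open import Relation.Binary.Reasoning.Setoid setoid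

  CongMod-intro : ∀ {a x y} r → x ≈ r * a + y → CongMod R a x y
  CongMod-intro {a} {x} {y} r x≈ra+y = r , (begin
    x - y           ≈⟨ +-congʳ x≈ra+y ⟩
    (r * a + y) - y ≈⟨ //-rightDividesʳ y (r * a) ⟩
    r * a           ∎)

  CongMod-elim : ∀ {a x y} → CongMod R a x y → ∃ λ r → x ≈ r * a + y
  CongMod-elim {a} {x} {y} (r , x-y≈ra) = r , trans (sym (//-rightDividesˡ y x)) (+-congʳ x-y≈ra)

  ≈⇒CongMod : ∀ {a x y} → x ≈ y → CongMod R a x y
  ≈⇒CongMod {a} {x} {y} x≈y =
    CongMod-intro 0# (trans x≈y (sym (trans (+-congʳ (zeroˡ a)) (+-identityˡ y))))

  CongMod-refl : ∀ {a x} → CongMod R a x x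
  CongMod-refl = ≈⇒CongMod refl

  CongMod-sym : ∀ {a x y} → CongMod R a x y → CongMod R a y x
  CongMod-sym {a} {x} {y} (r , x-y≈ra) = - r , (begin
    y - x       ≈⟨ ⁻¹-anti-homo‿- x y ⟨
    - (x - y)   ≈⟨ -‿cong x-y≈ra ⟩
    - (r * a)   ≈⟨ -‿distribˡ-* r a ⟩
    - r * a     ∎)

  CongMod-trans : ∀ {a x y z} → CongMod R a x y → CongMod R a y z → CongMod R a x z
  CongMod-trans {a} {x} {y} {z} x≡y y≡z with CongMod-elim x≡y | CongMod-elim y≡z
  ... | r , x≈ra+y | r' , y≈r'a+z = CongMod-intro (r + r') (begin
    x                    ≈⟨ x≈ra+y ⟩
    r * a + y            ≈⟨ +-congˡ y≈r'a+z ⟩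
    r * a + (r' * a + z) ≈⟨ solve 4 (λ r r' a z → r :* a :+ (r' :* a :+ z) := (r :+ r') :* a :+ z)
                                  refl r r' a z ⟩
    (r + r') * a + z     ∎)

  CongMod-*-congˡ : ∀ {a} z {x y} → CongMod R a x y → CongMod R a (z * x) (z * y)
  CongMod-*-congˡ {a} z {x} {y} x≡y with CongMod-elim x≡y
  ... | r , x≈ra+y = CongMod-intro (z * r) (begin
    z * x             ≈⟨ *-congˡ x≈ra+y ⟩
    z * (r * a + y)   ≈⟨ solve 4 (λ z r a y → z :* (r :* a :+ y) := (z :* r) :* a :+ z :* y) refl z r a y ⟩
    (z * r) * a + z * y ∎)

  CongMod-*-cong : ∀ {a x x' y y'} → CongMod R a x x' → CongMod R a y y' → CongMod R a (x * y) (x' * y')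
  CongMod-*-cong {x = x} {x'} {y} {y'} x≡x' y≡y' =
    CongMod-trans (CongMod-*-congˡ x y≡y')
      (CongMod-trans (≈⇒CongMod (*-comm x y'))
        (CongMod-trans (CongMod-*-congˡ y' x≡x') (≈⇒CongMod (*-comm y' x'))))

  CongMod-mono : ∀ {a b x y} → InIdeal R a b → CongMod R b x y → CongMod R a x y
  CongMod-mono {a} {b} (e , b≈ea) (r , x-y≈rb) =
    r * e , trans x-y≈rb (trans (*-congˡ b≈ea) (sym (*-assoc r e a)))

  CongMod-by-1# : ∀ {x y} → CongMod R 1# x y
  CongMod-by-1# {x} {y} = x - y , sym (*-identityʳ (x - y))

  CongMod-by-0# : ∀ {b x y} → b ≈ 0# → CongMod R b x y → x ≈ y
  CongMod-by-0# {b} {x} {y} b≈0 x≡y with CongMod-elim x≡y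
  ... | r , x≈rb+y = begin
    x          ≈⟨ x≈rb+y ⟩
    r * b + y  ≈⟨ +-congʳ (trans (*-congˡ b≈0) (zeroʳ r)) ⟩
    0# + y     ≈⟨ +-identityˡ y ⟩
    y          ∎

  unit⇒unitMod : ∀ {a x} → IsUnit R x → IsUnitMod R a x
  unit⇒unitMod (y , xy≈1) = y , ≈⇒CongMod xy≈1

  *-commutativeMonoid-mod : Carrier → CommutativeMonoid c (c ⊔ ℓ)
  *-commutativeMonoid-mod a = record
    { Carrier = Carrier ; _≈_ = CongMod R a ; _∙_ = _*_ ; ε = 1#
    ; isCommutativeMonoid = record
      { isMonoid = record
        { isSemigroup = record
          { isMagma = record
            { isEquivalence = record { refl = CongMod-refl ; sym = CongMod-sym ; trans = CongMod-trans }
            ; ∙-cong = CongMod-*-cong }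
          ; assoc = λ x y z → ≈⇒CongMod (*-assoc x y z) }
        ; identity = (λ x → ≈⇒CongMod (*-identityˡ x)) , (λ x → ≈⇒CongMod (*-identityʳ x)) }
      ; comm = λ x y → ≈⇒CongMod (*-comm x y) } }

  unitsMod-lagrange : ∀ {a n x} → UnitsModCard R a n → IsUnitMod R a x → CongMod R a (x ^ n) 1#
  unitsMod-lagrange {a} {n} {x} (_ , enum) x-unit =
    CongMod-trans (^≡^ₐ n) (Rₐ.units-lagrange enum x-unit)
    where
    module Rₐ = FiniteSubgroups (*-commutativeMonoid-mod a)
    ^≡^ₐ : ∀ m → CongMod R a (x ^ m) (x Rₐ.^ m)
    ^≡^ₐ zero    = CongMod-refl
    ^≡^ₐ (suc m) = CongMod-*-congˡ x (^≡^ₐ m)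

  binomial-≡ : ∀ u n → CongMod R (u * u) ((1# + u) ^ n) (1# + (n · 1#) * u)
  binomial-≡ u zero    = ≈⇒CongMod (sym (trans (+-congˡ (zeroˡ u)) (+-identityʳ 1#)))
  binomial-≡ u (suc n) =
    CongMod-trans (CongMod-*-congˡ (1# + u) (binomial-≡ u n)) (CongMod-intro N
      (solve 2 (λ u N → (con 1 :+ u) :* (con 1 :+ N :* u)
                        := N :* (u :* u) :+ (con 1 :+ (con 1 :+ N) :* u)) refl u N))
    where N = n · 1#

  -- (1 + u)^s ≡ 1 + s·u modulo u², and both u² and s·u lie in ⟨ab⟩.
  pow-char-step : ∀ {a b y s} → CongMod R a (s · 1#) 0# → InIdeal R a b → CongMod R b y 1# →
                  CongMod R (a * b) (y ^ s) 1#
  pow-char-step {a} {b} {y} {s} s≡0 (e , b≈ea) y≡1 with CongMod-elim y≡1 | CongMod-elim s≡0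
  ... | r , y≈rb+1 | t , s≈ta+0 =
    CongMod-trans (≈⇒CongMod (^-congˡ s (trans y≈rb+1 (+-comm (r * b) 1#))))
      (CongMod-trans (CongMod-mono u²∈⟨ab⟩ (binomial-≡ u s)) (CongMod-intro (t * r) (begin
        1# + (s · 1#) * u  ≈⟨ +-comm 1# _ ⟩
        (s · 1#) * u + 1#  ≈⟨ +-congʳ (*-congʳ (trans s≈ta+0 (+-identityʳ (t * a)))) ⟩
        (t * a) * u + 1#   ≈⟨ +-congʳ (solve 4 (λ t a r b → (t :* a) :* (r :* b) := (t :* r) :* (a :* b))
                                                refl t a r b) ⟩
        (t * r) * (a * b) + 1# ∎)))
    where
    u = r * b
    u²∈⟨ab⟩ : InIdeal R (a * b) (u * u)
    u²∈⟨ab⟩ = r * r * e , (begin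
      (r * b) * (r * b)        ≈⟨ *-congˡ (*-congˡ b≈ea) ⟩
      (r * b) * (r * (e * a))  ≈⟨ solve 4 (λ r b e a → (r :* b) :* (r :* (e :* a)) := (r :* r :* e) :* (a :* b))
                                          refl r b e a ⟩
      (r * r * e) * (a * b)    ∎)

  pow-char^-≡1 : ∀ {a y s} → CongMod R a (s · 1#) 0# → CongMod R a y 1# →
                 ∀ k → CongMod R (a ^ k) (y ^ (s ^ℕ (k ∸ 1))) 1#
  pow-char^-≡1 _ _ zero = CongMod-by-1#
  pow-char^-≡1 {a} {y} _ y≡1 (suc zero) =
    CongMod-mono (1# , sym (trans (*-identityˡ (a * 1#)) (*-identityʳ a)))
      (CongMod-trans (≈⇒CongMod (*-identityʳ y)) y≡1)
  pow-char^-≡1 {a} {y} {s} s≡0 y≡1 (suc (suc j)) =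
    CongMod-trans (≈⇒CongMod y^[s*s^j]≈[y^s^j]^s)
      (pow-char-step {s = s} s≡0 (a ^ j , *-comm a (a ^ j)) (pow-char^-≡1 s≡0 y≡1 (suc j)))
    where
    y^[s*s^j]≈[y^s^j]^s : y ^ (s *ℕ s ^ℕ j) ≈ (y ^ (s ^ℕ j)) ^ s
    y^[s*s^j]≈[y^s^j]^s = trans (^-congʳ y (ℕ.*-comm s (s ^ℕ j))) (sym (^-assocʳ y (s ^ℕ j) s))

  unit-pow≈1 : ∀ {a x} k s w → a ^ k ≈ 0# → CongMod R a (s · 1#) 0# →
               (∀ z → IsUnitMod R a z → CongMod R a (z ^ w) 1#) →
               IsUnit R x → x ^ (w *ℕ s ^ℕ (k ∸ 1)) ≈ 1#
  unit-pow≈1 {a} {x} k s w a^k≈0 s≡0 exponent x-unit =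
    trans (sym (^-assocʳ x w (s ^ℕ (k ∸ 1))))
      (CongMod-by-0# a^k≈0 (pow-char^-≡1 s≡0 (exponent x (unit⇒unitMod x-unit)) k))

  InIdeal-nilpotent : ∀ {a t} k → a ^ k ≈ 0# → InIdeal R a t → t ^ k ≈ 0#
  InIdeal-nilpotent {a} {t} k a^k≈0 (r , t≈ra) = begin
    t ^ k          ≈⟨ ^-congˡ k t≈ra ⟩
    (r * a) ^ k    ≈⟨ ^-distrib-* r a k ⟩
    r ^ k * a ^ k  ≈⟨ *-congˡ a^k≈0 ⟩
    r ^ k * 0#     ≈⟨ zeroʳ (r ^ k) ⟩
    0#             ∎

  -- The inverse of x = 1 - t is the truncated geometric series 1 + t + ⋯ + tᵏ.
  nilpotent+x≈1⇒unit : ∀ {t x} k → t ^ k ≈ 0# → t + x ≈ 1# → IsUnit R x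
  nilpotent+x≈1⇒unit {t} {x} k t^k≈0 t+x≈1 = geometric k , (begin
    x * geometric k                  ≈⟨ +-identityʳ _ ⟨
    x * geometric k + 0#             ≈⟨ +-congˡ (trans (*-congˡ t^k≈0) (zeroʳ t)) ⟨
    x * geometric k + t ^ suc k      ≈⟨ telescope k ⟩
    1#                               ∎)
    where
    x+t≈1 : x + t ≈ 1#
    x+t≈1 = trans (+-comm x t) t+x≈1
    geometric : ℕ → Carrier
    geometric zero    = 1#
    geometric (suc m) = 1# + t * geometric m
    telescope : ∀ m → x * geometric m + t ^ suc m ≈ 1#
    telescope zero    = trans (+-cong (*-identityʳ x) (*-identityʳ t)) x+t≈1
    telescope (suc m) = begin
      x * (1# + t * geometric m) + t * t ^ suc m
        ≈⟨ solve 4 (λ x t g T → x :* (con 1 :+ t :* g) :+ t :* T := x :+ t :* (x :* g :+ T))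
                   refl x t (geometric m) (t ^ suc m) ⟩
      x + t * (x * geometric m + t ^ suc m)      ≈⟨ +-congˡ (trans (*-congˡ (telescope m)) (*-identityʳ t)) ⟩
      x + t                                      ≈⟨ x+t≈1 ⟩
      1#                                         ∎

  ≡1⇒unit : ∀ {a z} k → a ^ k ≈ 0# → CongMod R a z 1# → IsUnit R z
  ≡1⇒unit {z = z} k a^k≈0 z≡1 =
    nilpotent+x≈1⇒unit k (InIdeal-nilpotent k a^k≈0 (CongMod-sym z≡1)) (//-rightDividesˡ z 1#)

  one+ideal-lagrange : ∀ {a m y} k → a ^ k ≈ 0# → IdealCard R a m → CongMod R a y 1# → y ^ m ≈ 1#
  one+ideal-lagrange {a} {m} k a^k≈0 (g , g∈⟨a⟩ , index , injective) =
    R*.lagrange ∙-closed inverse-closed {f = λ i → g i + 1#} (g+1≡1 , index+1 , injective+1)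
    where
    module R* = FiniteSubgroups *-commutativeMonoid
    ∙-closed : ∀ {x y} → CongMod R a x 1# → CongMod R a y 1# → CongMod R a (x * y) 1#
    ∙-closed x≡1 y≡1 = CongMod-trans (CongMod-*-cong x≡1 y≡1) (≈⇒CongMod (*-identityˡ 1#))
    inverse-closed : ∀ {x} → CongMod R a x 1# → ∃ λ y → CongMod R a y 1# × x * y ≈ 1#
    inverse-closed {x} x≡1 with ≡1⇒unit k a^k≈0 x≡1
    ... | y , xy≈1 = y , y≡1 , xy≈1
      where
      y≡1 : CongMod R a y 1#
      y≡1 = CongMod-trans (≈⇒CongMod (sym (*-identityʳ y)))
              (CongMod-trans (CongMod-*-congˡ y (CongMod-sym x≡1)) (≈⇒CongMod (trans (*-comm y x) xy≈1)))
    g+1≡1 : ∀ i → CongMod R a (g i + 1#) 1#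
    g+1≡1 i = CongMod-intro (proj₁ (g∈⟨a⟩ i)) (+-congʳ (proj₂ (g∈⟨a⟩ i)))
    index+1 : ∀ z → CongMod R a z 1# → ∃ λ i → z ≈ g i + 1#
    index+1 z z≡1 with CongMod-elim z≡1
    ... | r , z≈ra+1 with index (r * a) (r , refl)
    ... | i , lift ra≈gi = i , trans z≈ra+1 (+-congʳ ra≈gi)
    injective+1 : ∀ i j → g i + 1# ≈ g j + 1# → i ≡ j
    injective+1 i j e = injective i j (lift (+-cancelʳ 1# (g i) (g j) e))

corollary4p1 : ∀ {c ℓ} (R : CommutativeRing c ℓ) (a : CommutativeRing.Carrier R) (k s : ℕ)
    → NilpotencyIndex R a k
    → 1 < s
    → CharacteristicMod R a s
    → (∀ (w : ℕ)
         → (∀ x → IsUnitMod R a x → CongMod R a (pow R x w) (one R))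
         → ∀ x → IsUnit R x
         → Eq R (pow R x (w *ℕ (s ^ℕ (k ∸ 1)))) (one R))
    × (∀ (n : ℕ) → UnitsModCard R a n
         → ∀ x → IsUnit R x
         → Eq R (pow R x (n *ℕ (s ^ℕ (k ∸ 1)))) (one R))
    × ((∃ λ m → UnitsCard R m)
         → ∀ (n m : ℕ) → UnitsModCard R a n → IdealCard R a m
         → ∀ x → IsUnit R x
         → Eq R (pow R x (n *ℕ m)) (one R))
corollary4p1 R a k s (a^k≈0 , _) _ (_ , s≡0 , _) =
  (λ w exponent x x-unit → unit-pow≈1 k s w a^k≈0 s≡0 exponent x-unit) ,
  (λ n card x x-unit → unit-pow≈1 k s n a^k≈0 s≡0 (λ _ → unitsMod-lagrange card) x-unit) ,
  (λ _ n m card ideal-card x x-unit →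
     trans (sym (^-assocʳ x n m))
       (one+ideal-lagrange k a^k≈0 ideal-card (unitsMod-lagrange card (unit⇒unitMod x-unit))))
  where
  open CommutativeRing R using (trans; sym)
  open import Algebra.Properties.Semiring.Exp (CommutativeRing.semiring R) using (^-assocʳ)
  open PrincipalIdeals R
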